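{- For every $n\ge 0$, $|\mathrm{Av}_n(132,3214,4213)|=2^n-n$.
   Context: $\mathrm{Av}_n(\sigma_1,\dots,\sigma_r)$ denotes the set of permutations in $\mathfrak S_n$ that contain no subsequence order-isomorphic to any of $\sigma_1,\dots,\sigma_r$ (classical pattern avoidance). -}

module Defs where

open import Data.Bool using (Bool; true; false; _∧_; _∨_; not; if_then_else_)
open import Data.Nat using (ℕ; zero; suc; _<ᵇ_; _≡ᵇ_)
open import Data.List using (List; []; _∷_; _++_; length; filter; map; concatMap; upTo; zip)
open import Data.Bool.ListAction using (all; any)
open import Data.Bool using (T)
open import Relation.Nullary.Decidable using (T?)
open import Relation.Binary.PropositionalEquality using (_≡_)

words : ℕ → ℕ → List (List ℕ)
words m zero    = [] ∷ []
words m (suc k) = concatMap (λ w → map (_∷ w) (upTo m)) (words m k)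

elemᵇ : ℕ → List ℕ → Bool
elemᵇ x = any (x ≡ᵇ_)

distinctᵇ : List ℕ → Bool
distinctᵇ []       = true
distinctᵇ (x ∷ xs) = not (elemᵇ x xs) ∧ distinctᵇ xs

-- 𝔖_n: the permutations of {0,…,n-1} in one-line notation
-- (words of length n over {0,…,n-1} with no repeated entry).
Sn : ℕ → List (List ℕ)
Sn n = filter (λ w → T? (distinctᵇ w)) (words n n)

subseqs : List ℕ → List (List ℕ)
subseqs []       = [] ∷ []
subseqs (x ∷ xs) = let r = subseqs xs in map (x ∷_) r ++ r

orderIsoᵇ : List ℕ → List ℕ → Bool
orderIsoᵇ u v =
  (length u ≡ᵇ length v) ∧
  all (λ p → all (λ q → sameCmp p q) uv) uv
  where
  uv = zip u v
  open import Data.Product using (_×_; _,_)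
  sameCmp : ℕ × ℕ → ℕ × ℕ → Bool
  sameCmp (a , b) (c , d) = if (a <ᵇ c) then (b <ᵇ d) else not (b <ᵇ d)

containsᵇ : List ℕ → List ℕ → Bool
containsᵇ π σ = any (λ s → orderIsoᵇ s σ) (subseqs π)

avoidsᵇ : List (List ℕ) → List ℕ → Bool
avoidsᵇ ps π = all (λ σ → not (containsᵇ π σ)) ps

Av : ℕ → List (List ℕ) → List (List ℕ)
Av n ps = filter (λ π → T? (avoidsᵇ ps π)) (Sn n)

-- A 132-avoiding permutation π of {0, …, n} splits at its maximum as π = α n β with every entry
-- of α above every entry of β.  For such π, avoiding 3214 and 4213 means exactly that α avoids
-- 132 and 321 while β avoids 132 and 213.  Splitting these two classes at their maxima in the
-- same way shows that, in size k, the first has c k = 1 + k(k − 1)/2 members and the second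
-- b k = 2^(k − 1) members (k ≥ 1, and b 0 = 1).  Hence |Av_(n+1)| = ∑_{j ≤ n} c (n − j) · b j,
-- which is 2^(n+1) − (n + 1).  Each cardinality is computed by exhibiting a duplicate-free list
-- with the same members.

{-# OPTIONS --safe #-}
module Submission where

open import Defs
open import Data.Bool using (Bool; true; false; T; not; _∧_; if_then_else_)
open import Data.Bool.ListAction using (all)
open import Data.Bool.Properties using (T-∧)
open import Data.Empty using (⊥-elim)
open import Data.List
  using (List; []; _∷_; [_]; _++_; length; map; filter; concatMap; upTo; zip; cartesianProductWith)
open import Data.List.Properties
  using (map-cong; length-++; length-map; ∷-injective; ∷-injectiveˡ; ∷-injectiveʳ; map-applyUpTo; map-upTo)
open import Data.List.Membership.Propositional using (_∈_; _∉_; find; lose)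
open import Data.List.Membership.Propositional.Properties
  using ( ∈-++⁺ˡ; ∈-++⁺ʳ; ∈-++⁻; ∈-map⁺; ∈-map⁻; ∈-∃++; ∈-filter⁺; ∈-filter⁻; ∈-upTo⁺; ∈-upTo⁻
        ; ∈-concatMap⁺; ∈-concatMap⁻; ∈-cartesianProductWith⁺; ∈-cartesianProductWith⁻)
open import Data.List.Relation.Binary.Pointwise using (Pointwise; []; _∷_)
open import Data.List.Relation.Binary.Sublist.Propositional
  using (_⊆_; []; _∷_; _∷ʳ_; ⊆-refl; ⊆-trans; minimum; from∈; to∈; lookup)
open import Data.List.Relation.Binary.Sublist.Propositional.Properties using (++⁺; ++⁺ˡ; ++⁺ʳ; All-resp-⊆)
import Data.List.Relation.Binary.Subset.Propositional as Subset
open import Data.List.Relation.Unary.All as All using (All; []; _∷_)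
open import Data.List.Relation.Unary.All.Properties using (all⁺; all⁻; ¬Any⇒All¬; All¬⇒¬Any)
open import Data.List.Relation.Unary.AllPairs using ([]; _∷_)
open import Data.List.Relation.Unary.Any using (here; there)
open import Data.List.Relation.Unary.Any.Properties using (any⁺; any⁻)
open import Data.List.Relation.Unary.Unique.Propositional using (Unique)
import Data.List.Relation.Unary.Unique.Propositional.Properties as Unique
open import Data.Nat
  using (ℕ; zero; suc; _+_; _*_; _∸_; _^_; _≤_; _<_; z≤n; s≤s; z<s; s<s; _<ᵇ_; _≤ᵇ_; _≟_)
open import Data.List.Membership.DecPropositional _≟_ using (_∈?_)
open import Data.Nat.Induction using (<-rec)
open import Data.Nat.ListAction using (sum)
open import Data.Nat.Properties
open import Data.Nat.Tactic.RingSolver using (solve-∀)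
open import Data.Product using (∃₂; ∃-syntax; _×_; _,_; proj₁; proj₂; uncurry′)
open import Data.Product.Function.NonDependent.Propositional using (_×-⇔_)
open import Data.Sum using (_⊎_; inj₁; inj₂; [_,_]′)
open import Data.Unit using (⊤; tt)
open import Function using (_∘_; _⇔_; mk⇔; Equivalence)
open Equivalence using (to; from)
import Function.Properties.Equivalence as ⇔
open import Function.Related.TypeIsomorphisms using (→-cong-⇔)
open import Relation.Binary.Core using (_Preserves_⟶_)
open import Relation.Binary.Definitions using (tri<; tri≈; tri>)
open import Relation.Binary.PropositionalEquality hiding ([_])
open import Relation.Nullary using (¬_; yes; no; contradiction)
open import Relation.Nullary.Decidable using (T?)
open import Relation.Nullary.Reflects using (ofʸ; ofⁿ)

pattern 1st = here refl
pattern 2nd = there 1st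
pattern 3rd = there 2nd
pattern 4th = there 3rd

-- Duplicate-free lists and enumerations
module _ {A : Set} where

  private
    remove : ∀ {x : A} {ys} → x ∈ ys →
             ∃[ ys′ ] length ys ≡ suc (length ys′) × (∀ {z} → z ∈ ys → z ≢ x → z ∈ ys′)
    remove {ys = _ ∷ ys} (here refl) =
      ys , refl , λ { (here z≡x) z≢x → contradiction z≡x z≢x ; (there z∈ys) _ → z∈ys }
    remove {ys = y ∷ _} (there x∈ys) with remove x∈ys
    ... | ys′ , len≡ , keeps =
      y ∷ ys′ , cong suc len≡ , λ { (here z≡y) _ → here z≡y ; (there z∈ys) z≢x → there (keeps z∈ys z≢x) }

  Unique-length-≤ : ∀ {xs ys : List A} → Unique xs → xs Subset.⊆ ys → length xs ≤ length ys
  Unique-length-≤ {[]}     _              _     = z≤n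
  Unique-length-≤ {x ∷ xs} (x∉xs ∷ xs!) xs⊆ys with remove (xs⊆ys (here refl))
  ... | ys′ , len≡ , keeps =
    subst (suc (length xs) ≤_) (sym len≡) (s≤s (Unique-length-≤ xs! xs⊆ys′))
    where
    xs⊆ys′ : xs Subset.⊆ ys′
    xs⊆ys′ z∈xs = keeps (xs⊆ys (there z∈xs)) (All.lookup x∉xs z∈xs ∘ sym)

  Unique-length-< : ∀ {xs ys : List A} {y} → Unique xs → xs Subset.⊆ ys → y ∈ ys → y ∉ xs →
                    length xs < length ys
  Unique-length-< {xs} xs! xs⊆ys y∈ys y∉xs = Unique-length-≤ (y∉xs′ ∷ xs!) y∷xs⊆ys
    where
    y∉xs′ : All (_ ≢_) xs
    y∉xs′ = All.tabulate λ z∈xs y≡z → y∉xs (subst (_∈ xs) (sym y≡z) z∈xs)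
    y∷xs⊆ys : (_ ∷ xs) Subset.⊆ _
    y∷xs⊆ys (here refl)  = y∈ys
    y∷xs⊆ys (there z∈xs) = xs⊆ys z∈xs

  Unique-⊆ : ∀ {xs ys : List A} → xs ⊆ ys → Unique ys → Unique xs
  Unique-⊆ []         []          = []
  Unique-⊆ (_ ∷ʳ p)   (_ ∷ ys!)   = Unique-⊆ p ys!
  Unique-⊆ (refl ∷ p) (y∉ys ∷ ys!) = All-resp-⊆ p y∉ys ∷ Unique-⊆ p ys!

  Unique-pair : ∀ {x y : A} {ys} → x ∷ y ∷ [] ⊆ ys → Unique ys → x ≢ y
  Unique-pair p ys! with Unique-⊆ p ys!
  ... | (x≢y ∷ []) ∷ _ = x≢y

  Unique-concatMap : ∀ {B : Set} {f : A → List B} {xs} → Unique xs → (∀ {x} → x ∈ xs → Unique (f x)) →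
                     (∀ {x y z} → x ∈ xs → y ∈ xs → z ∈ f x → z ∈ f y → x ≡ y) → Unique (concatMap f xs)
  Unique-concatMap {xs = []}     _             _  _      = []
  Unique-concatMap {f = f} {xs = x ∷ xs} (x∉xs ∷ xs!) f! f-disj =
    Unique.++⁺ (f! 1st) (Unique-concatMap xs! (f! ∘ there) λ x∈ y∈ → f-disj (there x∈) (there y∈))
               disjoint
    where
    disjoint : ∀ {z} → ¬ (z ∈ f x × z ∈ concatMap f xs)
    disjoint (z∈fx , z∈rest) with find (∈-concatMap⁻ f z∈rest)
    ... | y , y∈xs , z∈fy = All.lookup x∉xs y∈xs (f-disj 1st (there y∈xs) z∈fx z∈fy)

  Unique-cartesianProductWith : ∀ {B C : Set} {f : A → B → C} {xs ys} → Unique xs → Unique ys →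
    (∀ {x x′ y y′} → x ∈ xs → x′ ∈ xs → f x y ≡ f x′ y′ → x ≡ x′ × y ≡ y′) →
    Unique (cartesianProductWith f xs ys)
  Unique-cartesianProductWith {xs = []}     _             _   _     = []
  Unique-cartesianProductWith {f = f} {xs = x ∷ xs} {ys} (x∉xs ∷ xs!) ys! f-inj =
    Unique.++⁺ (Unique.map⁺ (proj₂ ∘ f-inj 1st 1st) ys!)
               (Unique-cartesianProductWith xs! ys! λ x∈ x′∈ → f-inj (there x∈) (there x′∈))
               disjoint
    where
    disjoint : ∀ {z} → ¬ (z ∈ map (f x) ys × z ∈ cartesianProductWith f xs ys)
    disjoint (z∈ , z∈′) with ∈-map⁻ (f x) z∈ | ∈-cartesianProductWith⁻ f xs ys z∈′
    ... | _ , _ , refl | x′ , _ , x′∈ , _ , eq = All.lookup x∉xs x′∈ (proj₁ (f-inj 1st (there x′∈) eq))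

  record Enumerates (P : A → Set) (xs : List A) : Set where
    field
      unique   : Unique xs
      sound    : ∀ {x} → x ∈ xs → P x
      complete : ∀ {x} → P x → x ∈ xs

  Enumerates-length : ∀ {P xs ys} → Enumerates P xs → Enumerates P ys → length xs ≡ length ys
  Enumerates-length exs eys = ≤-antisym
    (Unique-length-≤ (unique exs) (complete eys ∘ sound exs))
    (Unique-length-≤ (unique eys) (complete exs ∘ sound eys))
    where open Enumerates

  Enumerates-cong : ∀ {P Q : A → Set} {xs} → (∀ x → P x ⇔ Q x) → Enumerates P xs → Enumerates Q xs
  Enumerates-cong P⇔Q e = record
    { unique = unique ; sound = to (P⇔Q _) ∘ sound ; complete = complete ∘ from (P⇔Q _) }
    where open Enumerates e

  filter-enumerates : ∀ {P Q : A → Set} {p : A → Bool} {xs} →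
                      Enumerates P xs → (∀ x → T (p x) ⇔ Q x) →
                      Enumerates (λ x → P x × Q x) (filter (T? ∘ p) xs)
  filter-enumerates {p = p} e p⇔Q = record
    { unique   = Unique.filter⁺ (T? ∘ p) unique
    ; sound    = λ x∈ → let x∈xs , px = ∈-filter⁻ (T? ∘ p) x∈ in sound x∈xs , to (p⇔Q _) px
    ; complete = λ (Px , Qx) → ∈-filter⁺ (T? ∘ p) (complete Px) (from (p⇔Q _) Qx)
    }
    where open Enumerates e

  singleton-enumerates : ∀ (x : A) → Enumerates (_≡ x) [ x ]
  singleton-enumerates x = record
    { unique = [] ∷ [] ; sound = λ { (here refl) → refl } ; complete = λ { refl → here refl } }

-- Permutations of an interval
interval : ℕ → ℕ → List ℕ
interval lo zero    = []
interval lo (suc n) = lo ∷ interval (suc lo) n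

length-interval : ∀ lo n → length (interval lo n) ≡ n
length-interval lo zero    = refl
length-interval lo (suc n) = cong suc (length-interval (suc lo) n)

∈-interval⁻ : ∀ {lo n x} → x ∈ interval lo n → lo ≤ x × x < lo + n
∈-interval⁻ {lo} {suc n} (here refl) = ≤-refl , m<m+n lo z<s
∈-interval⁻ {lo} {suc n} {x} (there x∈) with ∈-interval⁻ {suc lo} {n} x∈
... | lo<x , x<hi = <⇒≤ lo<x , subst (x <_) (sym (+-suc lo n)) x<hi

∈-interval⁺ : ∀ {lo n x} → lo ≤ x → x < lo + n → x ∈ interval lo n
∈-interval⁺ {lo} {zero}  lo≤x x<hi = contradiction (subst (_ <_) (+-identityʳ lo) x<hi) (≤⇒≯ lo≤x)
∈-interval⁺ {lo} {suc n} {x} lo≤x x<hi with lo ≟ x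
... | yes refl = here refl
... | no lo≢x  = there (∈-interval⁺ (≤∧≢⇒< lo≤x lo≢x) (subst (x <_) (+-suc lo n) x<hi))

interval-unique : ∀ lo n → Unique (interval lo n)
interval-unique lo zero    = []
interval-unique lo (suc n) =
  All.tabulate (λ x∈ lo≡x → <⇒≢ (proj₁ (∈-interval⁻ x∈)) lo≡x) ∷ interval-unique (suc lo) n

interval-⊆⇒length≥ : ∀ {lo n xs} → interval lo n Subset.⊆ xs → n ≤ length xs
interval-⊆⇒length≥ {lo} {n} ⊆xs =
  subst (_≤ _) (length-interval lo n) (Unique-length-≤ (interval-unique lo n) ⊆xs)

record Perm (lo n : ℕ) (π : List ℕ) : Set where
  field
    length≡ : length π ≡ n
    bounded : ∀ {x} → x ∈ π → lo ≤ x × x < lo + n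
    unique  : Unique π

  ∈-complete : ∀ {v} → lo ≤ v → v < lo + n → v ∈ π
  ∈-complete {v} lo≤v v<hi with v ∈? π
  ... | yes v∈π = v∈π
  ... | no  v∉π = contradiction (trans length≡ (sym (length-interval lo n))) (<⇒≢ π-shorter)
    where
    π-shorter : length π < length (interval lo n)
    π-shorter = Unique-length-< unique (uncurry′ ∈-interval⁺ ∘ bounded) (∈-interval⁺ lo≤v v<hi) v∉π

interval-perm : ∀ lo n → Perm lo n (interval lo n)
interval-perm lo n = record
  { length≡ = length-interval lo n ; bounded = ∈-interval⁻ ; unique = interval-unique lo n }

Perm-tail : ∀ {lo n π} → Perm lo (suc n) (lo ∷ π) → Perm (suc lo) n π
Perm-tail {lo} {n} {π} p = record
  { length≡ = suc-injective length≡
  ; bounded = λ {x} x∈π → ≤∧≢⇒< (proj₁ (bounded (there x∈π))) (All.lookup lo∉π x∈π)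
                         , subst (x <_) (+-suc lo n) (proj₂ (bounded (there x∈π)))
  ; unique  = π!
  }
  where
  open Perm p
  lo∉π : All (lo ≢_) π
  lo∉π with unique
  ... | lo∉π ∷ _ = lo∉π
  π! : Unique π
  π! with unique
  ... | _ ∷ π! = π!

Perm-∉ : ∀ {lo n π x} → Perm lo n π → lo + n ≤ x → x ∉ π
Perm-∉ p hi≤x x∈π = <⇒≱ (proj₂ (Perm.bounded p x∈π)) hi≤x

-- Pattern occurrences
record Contains (P : List ℕ → Set) (π : List ℕ) : Set where
  constructor contains
  field
    {occurrence} : List ℕ
    sublist      : occurrence ⊆ π
    shape        : P occurrence

Contains-mono : ∀ {P π π′} → π ⊆ π′ → Contains P π → Contains P π′
Contains-mono π⊆π′ (contains s⊆π shape) = contains (⊆-trans s⊆π π⊆π′) shape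

Contains-trans : ∀ {P Q π} → (∀ {s} → P s → Contains Q s) → Contains P π → Contains Q π
Contains-trans P⇒Q (contains s⊆π shape) = Contains-mono s⊆π (P⇒Q shape)

data Is21 : List ℕ → Set where
  is21 : ∀ {a b} → b < a → Is21 (a ∷ b ∷ [])

data Is132 : List ℕ → Set where
  is132 : ∀ {a b c} → a < c → c < b → Is132 (a ∷ b ∷ c ∷ [])

data Is213 : List ℕ → Set where
  is213 : ∀ {a b c} → b < a → a < c → Is213 (a ∷ b ∷ c ∷ [])

data Is321 : List ℕ → Set where
  is321 : ∀ {a b c} → c < b → b < a → Is321 (a ∷ b ∷ c ∷ [])

data Is3214 : List ℕ → Set where
  is3214 : ∀ {a b c d} → c < b → b < a → a < d → Is3214 (a ∷ b ∷ c ∷ d ∷ [])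

data Is4213 : List ℕ → Set where
  is4213 : ∀ {a b c d} → c < b → b < d → d < a → Is4213 (a ∷ b ∷ c ∷ d ∷ [])

Has21 Has132 Has213 Has321 Has3214 Has4213 : List ℕ → Set
Has21   = Contains Is21
Has132  = Contains Is132
Has213  = Contains Is213
Has321  = Contains Is321
Has3214 = Contains Is3214
Has4213 = Contains Is4213

132⇒21 : ∀ {s} → Is132 s → Has21 s
132⇒21 (is132 _ c<b) = contains (_ ∷ʳ refl ∷ refl ∷ []) (is21 c<b)

321⇒21 : ∀ {s} → Is321 s → Has21 s
321⇒21 (is321 c<b _) = contains (_ ∷ʳ refl ∷ refl ∷ []) (is21 c<b)

3214⇒321 : ∀ {s} → Is3214 s → Has321 s
3214⇒321 (is3214 c<b b<a _) = contains (refl ∷ refl ∷ refl ∷ _ ∷ʳ []) (is321 c<b b<a)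

3214⇒213 : ∀ {s} → Is3214 s → Has213 s
3214⇒213 (is3214 c<b b<a a<d) = contains (_ ∷ʳ refl ∷ refl ∷ refl ∷ []) (is213 c<b (<-trans b<a a<d))

4213⇒321 : ∀ {s} → Is4213 s → Has321 s
4213⇒321 (is4213 c<b b<d d<a) = contains (refl ∷ refl ∷ refl ∷ _ ∷ʳ []) (is321 c<b (<-trans b<d d<a))

4213⇒213 : ∀ {s} → Is4213 s → Has213 s
4213⇒213 (is4213 c<b b<d _) = contains (_ ∷ʳ refl ∷ refl ∷ refl ∷ []) (is213 c<b b<d)

interval-avoids-21 : ∀ lo n → ¬ Has21 (interval lo n)
interval-avoids-21 lo zero    (contains [] ())
interval-avoids-21 lo (suc n) (contains (_ ∷ʳ s⊆) shape) = interval-avoids-21 (suc lo) n (contains s⊆ shape)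
interval-avoids-21 lo (suc n) (contains (refl ∷ b∈) (is21 b<lo)) =
  <⇒≱ b<lo (<⇒≤ (proj₁ (∈-interval⁻ (to∈ b∈))))

21-avoiding-perm≡interval : ∀ {lo n π} → Perm lo n π → ¬ Has21 π → π ≡ interval lo n
21-avoiding-perm≡interval {lo} {zero}  {[]}    _ _ = refl
21-avoiding-perm≡interval {lo} {suc n} {x ∷ π} p no21 with x ≟ lo
... | yes refl = cong (lo ∷_) (21-avoiding-perm≡interval (Perm-tail p) (no21 ∘ Contains-mono (_ ∷ʳ ⊆-refl)))
... | no  x≢lo with Perm.∈-complete p ≤-refl (m<m+n lo z<s)
...   | here lo≡x  = contradiction (sym lo≡x) x≢lo
...   | there lo∈π = ⊥-elim (no21 (contains (refl ∷ from∈ lo∈π) (is21 lo<x)))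
  where
  lo<x : lo < x
  lo<x = ≤∧≢⇒< (proj₁ (Perm.bounded p 1st)) (x≢lo ∘ sym)
21-avoiding-perm≡interval {lo} {zero}  {_ ∷ _} p _ with () ← Perm.length≡ p
21-avoiding-perm≡interval {lo} {suc n} {[]}    p _ with () ← Perm.length≡ p

-- Boolean pattern containment
∈-subseqs⁻ : ∀ π {s} → s ∈ subseqs π → s ⊆ π
∈-subseqs⁻ []      (here refl) = []
∈-subseqs⁻ (x ∷ π) s∈ with ∈-++⁻ (map (x ∷_) (subseqs π)) s∈
... | inj₂ s∈′ = x ∷ʳ ∈-subseqs⁻ π s∈′
... | inj₁ s∈′ with ∈-map⁻ (x ∷_) s∈′
...   | _ , s′∈ , refl = refl ∷ ∈-subseqs⁻ π s′∈

∈-subseqs⁺ : ∀ {π s} → s ⊆ π → s ∈ subseqs π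
∈-subseqs⁺ []                      = here refl
∈-subseqs⁺ {x ∷ π} (.x ∷ʳ s⊆π)  = ∈-++⁺ʳ (map (x ∷_) (subseqs π)) (∈-subseqs⁺ s⊆π)
∈-subseqs⁺ {x ∷ π} (refl ∷ s⊆π) = ∈-++⁺ˡ (∈-map⁺ (x ∷_) (∈-subseqs⁺ s⊆π))

private
  sameCmp⇒ : ∀ a b c d → T (if a <ᵇ c then b <ᵇ d else not (b <ᵇ d)) → b < d → a < c
  sameCmp⇒ a b c d h b<d with a <ᵇ c | <ᵇ-reflects-< a c | b <ᵇ d | <ᵇ-reflects-< b d
  ... | true  | ofʸ a<c | _     | _         = a<c
  ... | false | ofⁿ _   | false | ofⁿ b≮d = contradiction b<d b≮d

  sameCmp⇐ : ∀ a b c d → (a < c → b < d) → (b < d → a < c) →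
             T (if a <ᵇ c then b <ᵇ d else not (b <ᵇ d))
  sameCmp⇐ a b c d to from with a <ᵇ c | <ᵇ-reflects-< a c | b <ᵇ d | <ᵇ-reflects-< b d
  ... | true  | ofʸ a<c | true  | _       = tt
  ... | true  | ofʸ a<c | false | ofⁿ b≮d = b≮d (to a<c)
  ... | false | ofⁿ a≮c | true  | ofʸ b<d = a≮c (from b<d)
  ... | false | ofⁿ _   | false | _       = tt

orderIsoᵇ-reflects-< : ∀ u v {a b x y} → T (orderIsoᵇ u v) →
                       (a , x) ∈ zip u v → (b , y) ∈ zip u v → x < y → a < b
orderIsoᵇ-reflects-< u v {a} {b} {x} {y} iso ax∈ by∈ =
  sameCmp⇒ a x b y (All.lookup (all⁺ _ (zip u v) (All.lookup pairs ax∈)) by∈)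
  where pairs = all⁺ _ (zip u v) (proj₂ (to T-∧ iso))

private
  ∈-zip-map : ∀ {f : ℕ → ℕ} {σ p} → p ∈ zip (map f σ) σ → ∃[ x ] p ≡ (f x , x)
  ∈-zip-map {σ = x ∷ σ} (here refl) = x , refl
  ∈-zip-map {σ = x ∷ σ} (there p∈) = ∈-zip-map p∈

  reflects-< : ∀ {f} → f Preserves _<_ ⟶ _<_ → ∀ {x y} → f x < f y → x < y
  reflects-< {f} f-mono {x} {y} fx<fy with <-cmp x y
  ... | tri< x<y _ _ = x<y
  ... | tri≈ _ refl _ = contradiction fx<fy (<-irrefl refl)
  ... | tri> _ _ y<x = contradiction fx<fy (<-asym (f-mono y<x))

orderIsoᵇ-map : ∀ {f} → f Preserves _<_ ⟶ _<_ → ∀ σ → T (orderIsoᵇ (map f σ) σ)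
orderIsoᵇ-map {f} f-mono σ = from T-∧
  (≡⇒≡ᵇ _ _ (length-map f σ) ,
   all⁻ _ (All.tabulate λ p∈ → all⁻ _ (All.tabulate λ q∈ →
     same (∈-zip-map {f} {σ} p∈) (∈-zip-map {f} {σ} q∈))))
  where
  same : ∀ {p q} → ∃[ x ] p ≡ (f x , x) → ∃[ y ] q ≡ (f y , y) →
         T (if proj₁ p <ᵇ proj₁ q then proj₂ p <ᵇ proj₂ q else not (proj₂ p <ᵇ proj₂ q))
  same (x , refl) (y , refl) = sameCmp⇐ (f x) x (f y) y (reflects-< f-mono) f-mono

through : ℕ → ℕ → ℕ → ℕ → ℕ → ℕ
through w x y z 0                   = w
through w x y z 1                   = x
through w x y z 2                   = y
through w x y z (suc (suc (suc n))) = n + z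

through-increasing : ∀ {w x y z} → w < x → x < y → y < z → through w x y z Preserves _<_ ⟶ _<_
through-increasing {w} {x} {y} {z} w<x x<y y<z = increasing
  where
  below : ∀ {v} n → v < z → v < n + z
  below {v} n v<z = <-≤-trans v<z (m≤n+m z n)
  increasing : ∀ {i j} → i < j → through w x y z i < through w x y z j
  increasing {0}                   {1}                   _ = w<x
  increasing {0}                   {2}                   _ = <-trans w<x x<y
  increasing {0}                   {suc (suc (suc n))}   _ = below n (<-trans w<x (<-trans x<y y<z))
  increasing {1}                   {2}                   _ = x<y
  increasing {1}                   {suc (suc (suc n))}   _ = below n (<-trans x<y y<z)
  increasing {2}                   {suc (suc (suc n))}   _ = below n y<z
  increasing {suc (suc (suc m))}   {suc (suc (suc n))}   (s<s (s<s (s<s m<n))) = +-monoˡ-< z m<n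
  increasing {_}                   {0}                   ()
  increasing {suc _}               {1}                   (s<s ())
  increasing {suc (suc _)}         {2}                   (s<s (s<s ()))

_Recognises_ : List ℕ → (List ℕ → Set) → Set
σ Recognises P = ∀ s → T (orderIsoᵇ s σ) ⇔ P s

σ132 σ213 σ321 σ3214 σ4213 : List ℕ
σ132  = 0 ∷ 2 ∷ 1 ∷ []
σ213  = 1 ∷ 0 ∷ 2 ∷ []
σ321  = 2 ∷ 1 ∷ 0 ∷ []
σ3214 = 2 ∷ 1 ∷ 0 ∷ 3 ∷ []
σ4213 = 3 ∷ 1 ∷ 0 ∷ 2 ∷ []

recognises-132 : σ132 Recognises Is132
recognises-132 s@(a ∷ b ∷ c ∷ []) = mk⇔
  (λ iso → is132 (orderIsoᵇ-reflects-< s σ132 iso 1st 3rd ≤-refl)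
                  (orderIsoᵇ-reflects-< s σ132 iso 3rd 2nd ≤-refl))
  (λ { (is132 a<c c<b) → orderIsoᵇ-map (through-increasing a<c c<b ≤-refl) σ132 })
recognises-132 []                    = mk⇔ (λ ()) (λ ())
recognises-132 (_ ∷ [])              = mk⇔ (λ ()) (λ ())
recognises-132 (_ ∷ _ ∷ [])          = mk⇔ (λ ()) (λ ())
recognises-132 (_ ∷ _ ∷ _ ∷ _ ∷ _)   = mk⇔ (λ ()) (λ ())

recognises-213 : σ213 Recognises Is213
recognises-213 s@(a ∷ b ∷ c ∷ []) = mk⇔
  (λ iso → is213 (orderIsoᵇ-reflects-< s σ213 iso 2nd 1st ≤-refl)
                  (orderIsoᵇ-reflects-< s σ213 iso 1st 3rd ≤-refl))
  (λ { (is213 b<a a<c) → orderIsoᵇ-map (through-increasing b<a a<c ≤-refl) σ213 })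
recognises-213 []                  = mk⇔ (λ ()) (λ ())
recognises-213 (_ ∷ [])            = mk⇔ (λ ()) (λ ())
recognises-213 (_ ∷ _ ∷ [])        = mk⇔ (λ ()) (λ ())
recognises-213 (_ ∷ _ ∷ _ ∷ _ ∷ _) = mk⇔ (λ ()) (λ ())

recognises-321 : σ321 Recognises Is321
recognises-321 s@(a ∷ b ∷ c ∷ []) = mk⇔
  (λ iso → is321 (orderIsoᵇ-reflects-< s σ321 iso 3rd 2nd ≤-refl)
                  (orderIsoᵇ-reflects-< s σ321 iso 2nd 1st ≤-refl))
  (λ { (is321 c<b b<a) → orderIsoᵇ-map (through-increasing c<b b<a ≤-refl) σ321 })
recognises-321 []                  = mk⇔ (λ ()) (λ ())
recognises-321 (_ ∷ [])            = mk⇔ (λ ()) (λ ())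
recognises-321 (_ ∷ _ ∷ [])        = mk⇔ (λ ()) (λ ())
recognises-321 (_ ∷ _ ∷ _ ∷ _ ∷ _) = mk⇔ (λ ()) (λ ())

recognises-3214 : σ3214 Recognises Is3214
recognises-3214 s@(a ∷ b ∷ c ∷ d ∷ []) = mk⇔
  (λ iso → is3214 (orderIsoᵇ-reflects-< s σ3214 iso 3rd 2nd ≤-refl)
                   (orderIsoᵇ-reflects-< s σ3214 iso 2nd 1st ≤-refl)
                   (orderIsoᵇ-reflects-< s σ3214 iso 1st 4th ≤-refl))
  (λ { (is3214 c<b b<a a<d) → orderIsoᵇ-map (through-increasing c<b b<a a<d) σ3214 })
recognises-3214 []                      = mk⇔ (λ ()) (λ ())
recognises-3214 (_ ∷ [])                = mk⇔ (λ ()) (λ ())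
recognises-3214 (_ ∷ _ ∷ [])            = mk⇔ (λ ()) (λ ())
recognises-3214 (_ ∷ _ ∷ _ ∷ [])        = mk⇔ (λ ()) (λ ())
recognises-3214 (_ ∷ _ ∷ _ ∷ _ ∷ _ ∷ _) = mk⇔ (λ ()) (λ ())

recognises-4213 : σ4213 Recognises Is4213
recognises-4213 s@(a ∷ b ∷ c ∷ d ∷ []) = mk⇔
  (λ iso → is4213 (orderIsoᵇ-reflects-< s σ4213 iso 3rd 2nd ≤-refl)
                   (orderIsoᵇ-reflects-< s σ4213 iso 2nd 4th ≤-refl)
                   (orderIsoᵇ-reflects-< s σ4213 iso 4th 1st ≤-refl))
  (λ { (is4213 c<b b<d d<a) → orderIsoᵇ-map (through-increasing c<b b<d d<a) σ4213 })
recognises-4213 []                      = mk⇔ (λ ()) (λ ())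
recognises-4213 (_ ∷ [])                = mk⇔ (λ ()) (λ ())
recognises-4213 (_ ∷ _ ∷ [])            = mk⇔ (λ ()) (λ ())
recognises-4213 (_ ∷ _ ∷ _ ∷ [])        = mk⇔ (λ ()) (λ ())
recognises-4213 (_ ∷ _ ∷ _ ∷ _ ∷ _ ∷ _) = mk⇔ (λ ()) (λ ())

containsᵇ⇔ : ∀ {σ P} → σ Recognises P → ∀ π → T (containsᵇ π σ) ⇔ Contains P π
containsᵇ⇔ {σ} {P} rec π = mk⇔ sound complete
  where
  sound : T (containsᵇ π σ) → Contains P π
  sound h with find (any⁻ _ (subseqs π) h)
  ... | s , s∈ , iso = contains (∈-subseqs⁻ π s∈) (to (rec s) iso)
  complete : Contains P π → T (containsᵇ π σ)
  complete (contains s⊆π shape) = any⁺ _ (lose (∈-subseqs⁺ s⊆π) (from (rec _) shape))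

Avoids : List (List ℕ → Set) → List ℕ → Set
Avoids []       π = ⊤
Avoids (P ∷ Ps) π = ¬ Contains P π × Avoids Ps π

private
  T-not : ∀ {b} → T (not b) ⇔ (¬ T b)
  T-not {true}  = mk⇔ (λ ()) (λ ¬t → ¬t tt)
  T-not {false} = mk⇔ (λ _ ()) (λ _ → tt)

  ¬-⇔ : ∀ {A B : Set} → A ⇔ B → (¬ A) ⇔ (¬ B)
  ¬-⇔ A⇔B = →-cong-⇔ A⇔B ⇔.refl

avoidsᵇ⇔Avoids : ∀ {σs Ps} → Pointwise _Recognises_ σs Ps → ∀ π → T (avoidsᵇ σs π) ⇔ Avoids Ps π
avoidsᵇ⇔Avoids []           π = mk⇔ (λ _ → tt) (λ _ → tt)
avoidsᵇ⇔Avoids (rec ∷ recs) π =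
  ⇔.trans T-∧ (⇔.trans T-not (¬-⇔ (containsᵇ⇔ rec π)) ×-⇔ avoidsᵇ⇔Avoids recs π)

∈-words⁻ : ∀ m k {w} → w ∈ words m k → length w ≡ k × All (_< m) w
∈-words⁻ m zero    1st = refl , []
∈-words⁻ m (suc k) w∈ with find (∈-concatMap⁻ (λ v → map (_∷ v) (upTo m)) {words m k} w∈)
... | v , v∈ , w∈′ with ∈-map⁻ (_∷ v) w∈′
...   | x , x∈ , refl with ∈-words⁻ m k v∈
...     | length≡ , v<m = cong suc length≡ , ∈-upTo⁻ x∈ ∷ v<m

∈-words⁺ : ∀ {m w} → All (_< m) w → w ∈ words m (length w)
∈-words⁺                []            = 1st
∈-words⁺ {m} {x ∷ w} (x<m ∷ w<m) =
  ∈-concatMap⁺ _ (lose (∈-words⁺ w<m) (∈-map⁺ (_∷ w) (∈-upTo⁺ x<m)))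

words-unique : ∀ m k → Unique (words m k)
words-unique m zero    = [] ∷ []
words-unique m (suc k) =
  Unique-concatMap (words-unique m k) (λ _ → Unique.map⁺ ∷-injectiveˡ (Unique.upTo⁺ m)) same-tail
  where
  same-tail : ∀ {v v′ z} → v ∈ words m k → v′ ∈ words m k →
              z ∈ map (_∷ v) (upTo m) → z ∈ map (_∷ v′) (upTo m) → v ≡ v′
  same-tail _ _ z∈ z∈′ with ∈-map⁻ _ z∈ | ∈-map⁻ _ z∈′
  ... | _ , _ , refl | _ , _ , refl = refl

words-enumerates : ∀ m k → Enumerates (λ w → length w ≡ k × All (_< m) w) (words m k)
words-enumerates m k = record
  { unique   = words-unique m k
  ; sound    = ∈-words⁻ m k
  ; complete = λ { (refl , w<m) → ∈-words⁺ w<m }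
  }

elemᵇ⇔∈ : ∀ {x xs} → T (elemᵇ x xs) ⇔ x ∈ xs
elemᵇ⇔∈ {x} {xs} = mk⇔
  (λ h → let y , y∈ , x≡ᵇy = find (any⁻ _ xs h) in subst (_∈ xs) (sym (≡ᵇ⇒≡ x y x≡ᵇy)) y∈)
  (λ x∈ → any⁺ _ (lose x∈ (≡⇒≡ᵇ x x refl)))

distinctᵇ⇔Unique : ∀ w → T (distinctᵇ w) ⇔ Unique w
distinctᵇ⇔Unique []      = mk⇔ (λ _ → []) (λ _ → tt)
distinctᵇ⇔Unique (x ∷ w) = mk⇔
  (λ h → let x∉w , w! = to T-∧ h in
         ¬Any⇒All¬ w (to T-not x∉w ∘ from elemᵇ⇔∈) ∷ to (distinctᵇ⇔Unique w) w!)
  (λ { (x∉w ∷ w!) →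
         from T-∧ (from T-not (All¬⇒¬Any x∉w ∘ to elemᵇ⇔∈) , from (distinctᵇ⇔Unique w) w!) })

allᵇ-≤⇔ : ∀ lo w → T (all (lo ≤ᵇ_) w) ⇔ All (lo ≤_) w
allᵇ-≤⇔ lo w = mk⇔ (All.map (≤ᵇ⇒≤ lo _) ∘ all⁺ _ w) (all⁻ _ ∘ All.map ≤⇒≤ᵇ)

Perm⇔ : ∀ lo n π → ((length π ≡ n × All (_< lo + n) π) × (Unique π × All (lo ≤_) π)) ⇔ Perm lo n π
Perm⇔ lo n π = mk⇔
  (λ ((length≡ , <hi) , π! , lo≤) → record
    { length≡ = length≡ ; bounded = λ x∈ → All.lookup lo≤ x∈ , All.lookup <hi x∈ ; unique = π! })
  (λ p → let open Perm p in
    (length≡ , All.tabulate (proj₂ ∘ bounded)) , unique , All.tabulate (proj₁ ∘ bounded))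

perms : ℕ → ℕ → List (List ℕ)
perms lo n = filter (λ w → T? (distinctᵇ w ∧ all (lo ≤ᵇ_) w)) (words (lo + n) n)

perms-enumerates : ∀ lo n → Enumerates (Perm lo n) (perms lo n)
perms-enumerates lo n = Enumerates-cong (Perm⇔ lo n)
  (filter-enumerates (words-enumerates (lo + n) n)
                     λ w → ⇔.trans T-∧ (distinctᵇ⇔Unique w ×-⇔ allᵇ-≤⇔ lo w))

Sn-enumerates : ∀ n → Enumerates (Perm 0 n) (Sn n)
Sn-enumerates n = Enumerates-cong (λ π → ⇔.trans 0≤-vacuous (Perm⇔ 0 n π))
  (filter-enumerates (words-enumerates n n) distinctᵇ⇔Unique)
  where
  0≤-vacuous : ∀ {A : Set} {π} → (A × Unique π) ⇔ (A × Unique π × All (0 ≤_) π)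
  0≤-vacuous = mk⇔ (λ (w , π!) → w , π! , All.tabulate λ _ → z≤n) (λ (w , π! , _) → w , π!)

Avoiding : List (List ℕ → Set) → ℕ → ℕ → List ℕ → Set
Avoiding Ps lo n π = Perm lo n π × Avoids Ps π

avoiders : List (List ℕ) → ℕ → ℕ → List (List ℕ)
avoiders σs lo n = filter (λ π → T? (avoidsᵇ σs π)) (perms lo n)

avoiders-enumerates : ∀ {σs Ps} → Pointwise _Recognises_ σs Ps →
                      ∀ lo n → Enumerates (Avoiding Ps lo n) (avoiders σs lo n)
avoiders-enumerates recs lo n = filter-enumerates (perms-enumerates lo n) (avoidsᵇ⇔Avoids recs)

Av-enumerates : ∀ {σs Ps} → Pointwise _Recognises_ σs Ps →
                ∀ n → Enumerates (Avoiding Ps 0 n) (Av n σs)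
Av-enumerates recs n = filter-enumerates (Sn-enumerates n) (avoidsᵇ⇔Avoids recs)

-- Splitting at the maximum
⊆-++⁻ : ∀ (xs : List ℕ) {ys s} → s ⊆ xs ++ ys →
        ∃₂ λ s₁ s₂ → s ≡ s₁ ++ s₂ × s₁ ⊆ xs × s₂ ⊆ ys
⊆-++⁻ []       s⊆ = [] , _ , refl , [] , s⊆
⊆-++⁻ (x ∷ xs) (.x ∷ʳ s⊆) with ⊆-++⁻ xs s⊆
... | s₁ , s₂ , refl , s₁⊆ , s₂⊆ = s₁ , s₂ , refl , x ∷ʳ s₁⊆ , s₂⊆
⊆-++⁻ (x ∷ xs) (refl ∷ s⊆) with ⊆-++⁻ xs s⊆
... | s₁ , s₂ , refl , s₁⊆ , s₂⊆ = x ∷ s₁ , s₂ , refl , refl ∷ s₁⊆ , s₂⊆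

data Split3 (α : List ℕ) (M : ℕ) (β : List ℕ) : ℕ → ℕ → ℕ → Set where
  ααα : ∀ {a b c} → (a ∷ b ∷ c ∷ []) ⊆ α → Split3 α M β a b c
  ααM : ∀ {a b}   → (a ∷ b ∷ []) ⊆ α → Split3 α M β a b M
  ααβ : ∀ {a b c} → (a ∷ b ∷ []) ⊆ α → c ∈ β → Split3 α M β a b c
  αMβ : ∀ {a c}   → a ∈ α → c ∈ β → Split3 α M β a M c
  αββ : ∀ {a b c} → a ∈ α → (b ∷ c ∷ []) ⊆ β → Split3 α M β a b c
  Mββ : ∀ {b c}   → (b ∷ c ∷ []) ⊆ β → Split3 α M β M b c
  βββ : ∀ {a b c} → (a ∷ b ∷ c ∷ []) ⊆ β → Split3 α M β a b c

split3 : ∀ α {M β a b c} → (a ∷ b ∷ c ∷ []) ⊆ α ++ M ∷ β → Split3 α M β a b c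
split3 α {M} {β} occ with ⊆-++⁻ α {M ∷ β} occ
... | []                 , _ , refl , _  , _ ∷ʳ q   = βββ q
... | []                 , _ , refl , _  , refl ∷ q = Mββ q
... | _ ∷ []             , _ , refl , p  , _ ∷ʳ q   = αββ (to∈ p) q
... | _ ∷ []             , _ , refl , p  , refl ∷ q = αMβ (to∈ p) (to∈ q)
... | _ ∷ _ ∷ []         , _ , refl , p  , _ ∷ʳ q   = ααβ p (to∈ q)
... | _ ∷ _ ∷ []         , _ , refl , p  , refl ∷ _ = ααM p
... | _ ∷ _ ∷ _ ∷ []     , _ , refl , p  , _        = ααα p

data Split4 (α : List ℕ) (M : ℕ) (β : List ℕ) : ℕ → ℕ → ℕ → ℕ → Set where
  αααα : ∀ {a b c d} → (a ∷ b ∷ c ∷ d ∷ []) ⊆ α → Split4 α M β a b c d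
  αααM : ∀ {a b c}   → (a ∷ b ∷ c ∷ []) ⊆ α → Split4 α M β a b c M
  αααβ : ∀ {a b c d} → (a ∷ b ∷ c ∷ []) ⊆ α → d ∈ β → Split4 α M β a b c d
  ααMβ : ∀ {a b d}   → (a ∷ b ∷ []) ⊆ α → d ∈ β → Split4 α M β a b M d
  ααββ : ∀ {a b c d} → (a ∷ b ∷ []) ⊆ α → (c ∷ d ∷ []) ⊆ β → Split4 α M β a b c d
  αMββ : ∀ {a c d}   → a ∈ α → (c ∷ d ∷ []) ⊆ β → Split4 α M β a M c d
  αβββ : ∀ {a b c d} → a ∈ α → (b ∷ c ∷ d ∷ []) ⊆ β → Split4 α M β a b c d
  Mβββ : ∀ {b c d}   → (b ∷ c ∷ d ∷ []) ⊆ β → Split4 α M β M b c d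
  ββββ : ∀ {a b c d} → (a ∷ b ∷ c ∷ d ∷ []) ⊆ β → Split4 α M β a b c d

split4 : ∀ α {M β a b c d} → (a ∷ b ∷ c ∷ d ∷ []) ⊆ α ++ M ∷ β → Split4 α M β a b c d
split4 α {M} {β} occ with ⊆-++⁻ α {M ∷ β} occ
... | []                 , _ , refl , _  , _ ∷ʳ q   = ββββ q
... | []                 , _ , refl , _  , refl ∷ q = Mβββ q
... | _ ∷ []             , _ , refl , p  , _ ∷ʳ q   = αβββ (to∈ p) q
... | _ ∷ []             , _ , refl , p  , refl ∷ q = αMββ (to∈ p) q
... | _ ∷ _ ∷ []         , _ , refl , p  , _ ∷ʳ q   = ααββ p q
... | _ ∷ _ ∷ []         , _ , refl , p  , refl ∷ q = ααMβ p (to∈ q)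
... | _ ∷ _ ∷ _ ∷ []     , _ , refl , p  , _ ∷ʳ q   = αααβ p (to∈ q)
... | _ ∷ _ ∷ _ ∷ []     , _ , refl , p  , refl ∷ _ = αααM p
... | _ ∷ _ ∷ _ ∷ _ ∷ [] , _ , refl , p  , _        = αααα p

-- The conditions making α ++ M ∷ β the skew sum (α ⊕ 1) ⊖ β.
record SkewSum (M : ℕ) (α β : List ℕ) : Set where
  field
    β<α : ∀ {a b} → a ∈ α → b ∈ β → b < a
    α<M : ∀ {a} → a ∈ α → a < M
    β<M : ∀ {b} → b ∈ β → b < M

α⊆α++M∷β : ∀ (α : List ℕ) {M β} → α ⊆ α ++ M ∷ β
α⊆α++M∷β α {M} {β} = ++⁺ʳ (M ∷ β) ⊆-refl

β⊆α++M∷β : ∀ (α : List ℕ) {M β} → β ⊆ α ++ M ∷ β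
β⊆α++M∷β α {M} = ++⁺ˡ α (M ∷ʳ ⊆-refl)

module _ {M α β} (skew : SkewSum M α β) where
  open SkewSum skew

  132-split : Has132 (α ++ M ∷ β) → Has132 α ⊎ Has132 β
  132-split (contains occ (is132 a<c c<b)) with split3 α occ
  ... | ααα p     = inj₁ (contains p (is132 a<c c<b))
  ... | ααM p     = contradiction (α<M (lookup p 2nd)) (<-asym c<b)
  ... | ααβ p c∈  = contradiction (β<α (to∈ p) c∈) (<-asym a<c)
  ... | αMβ a∈ c∈ = contradiction (β<α a∈ c∈) (<-asym a<c)
  ... | αββ a∈ q  = contradiction (β<α a∈ (lookup q 2nd)) (<-asym a<c)
  ... | Mββ q     = contradiction (β<M (lookup q 2nd)) (<-asym a<c)
  ... | βββ q     = inj₂ (contains q (is132 a<c c<b))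

  213-split : Has213 (α ++ M ∷ β) → Has21 α ⊎ Has213 β
  213-split (contains occ (is213 b<a a<c)) with split3 α occ
  ... | ααα p     = inj₁ (contains (⊆-trans (refl ∷ refl ∷ _ ∷ʳ []) p) (is21 b<a))
  ... | ααM p     = inj₁ (contains p (is21 b<a))
  ... | ααβ p c∈  = contradiction (β<α (to∈ p) c∈) (<-asym a<c)
  ... | αMβ a∈ c∈ = contradiction (α<M a∈) (<-asym b<a)
  ... | αββ a∈ q  = contradiction (β<α a∈ (lookup q 2nd)) (<-asym a<c)
  ... | Mββ q     = contradiction (β<M (lookup q 2nd)) (<-asym a<c)
  ... | βββ q     = inj₂ (contains q (is213 b<a a<c))

  321-split : Has321 (α ++ M ∷ β) → Has321 α ⊎ Has21 β ⊎ (Has21 α × ∃[ b ] b ∈ β)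
  321-split (contains occ (is321 c<b b<a)) with split3 α occ
  ... | ααα p     = inj₁ (contains p (is321 c<b b<a))
  ... | ααM p     = contradiction (α<M (lookup p 2nd)) (<-asym c<b)
  ... | ααβ p c∈  = inj₂ (inj₂ (contains p (is21 b<a) , _ , c∈))
  ... | αMβ a∈ _  = contradiction (α<M a∈) (<-asym b<a)
  ... | αββ _ q   = inj₂ (inj₁ (contains q (is21 c<b)))
  ... | Mββ q     = inj₂ (inj₁ (contains q (is21 c<b)))
  ... | βββ q     = inj₂ (inj₁ (Contains-mono q (321⇒21 (is321 c<b b<a))))

  3214-split : Has3214 (α ++ M ∷ β) → Has321 α ⊎ Has3214 β
  3214-split (contains occ (is3214 c<b b<a a<d)) with split4 α occ
  ... | αααα p     = inj₁ (Contains-mono p (3214⇒321 (is3214 c<b b<a a<d)))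
  ... | αααM p     = inj₁ (contains p (is321 c<b b<a))
  ... | αααβ p d∈  = contradiction (β<α (to∈ p) d∈) (<-asym a<d)
  ... | ααMβ p _   = contradiction (α<M (lookup p 2nd)) (<-asym c<b)
  ... | ααββ p q   = contradiction (β<α (to∈ p) (lookup q 2nd)) (<-asym a<d)
  ... | αMββ a∈ _  = contradiction (α<M a∈) (<-asym b<a)
  ... | αβββ a∈ q  = contradiction (β<α a∈ (lookup q 3rd)) (<-asym a<d)
  ... | Mβββ q     = contradiction (β<M (lookup q 3rd)) (<-asym a<d)
  ... | ββββ q     = inj₂ (contains q (is3214 c<b b<a a<d))

  4213-split : Has4213 (α ++ M ∷ β) → Has4213 α ⊎ Has213 β
  4213-split (contains occ (is4213 c<b b<d d<a)) with split4 α occ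
  ... | αααα p     = inj₁ (contains p (is4213 c<b b<d d<a))
  ... | αααM p     = contradiction (α<M (to∈ p)) (<-asym d<a)
  ... | αααβ p d∈  = contradiction (β<α (lookup p 2nd) d∈) (<-asym b<d)
  ... | ααMβ p _   = contradiction (α<M (lookup p 2nd)) (<-asym c<b)
  ... | ααββ p q   = contradiction (β<α (lookup p 2nd) (lookup q 2nd)) (<-asym b<d)
  ... | αMββ _ q   = contradiction (β<M (lookup q 2nd)) (<-asym b<d)
  ... | αβββ _ q   = inj₂ (contains q (is213 c<b b<d))
  ... | Mβββ q     = inj₂ (contains q (is213 c<b b<d))
  ... | ββββ q     = inj₂ (Contains-mono q (4213⇒213 (is4213 c<b b<d d<a)))

  21-in-α⇒213 : Has21 α → Has213 (α ++ M ∷ β)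
  21-in-α⇒213 (contains p (is21 b<a)) =
    contains (++⁺ p (refl ∷ minimum β)) (is213 b<a (α<M (to∈ p)))

  21-in-α⇒321 : ∀ {c} → Has21 α → c ∈ β → Has321 (α ++ M ∷ β)
  21-in-α⇒321 (contains p (is21 b<a)) c∈ =
    contains (++⁺ p (M ∷ʳ from∈ c∈)) (is321 (β<α (lookup p 2nd) c∈) b<a)

  321-in-α⇒3214 : Has321 α → Has3214 (α ++ M ∷ β)
  321-in-α⇒3214 (contains p (is321 c<b b<a)) =
    contains (++⁺ p (refl ∷ minimum β)) (is3214 c<b b<a (α<M (to∈ p)))

  21-in-β⇒321 : Has21 β → Has321 (α ++ M ∷ β)
  21-in-β⇒321 (contains q (is21 b<a)) =
    contains (++⁺ (minimum α) (refl ∷ q)) (is321 b<a (β<M (to∈ q)))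

  213-in-β⇒4213 : Has213 β → Has4213 (α ++ M ∷ β)
  213-in-β⇒4213 (contains q (is213 b<a a<c)) =
    contains (++⁺ (minimum α) (refl ∷ q)) (is4213 b<a a<c (β<M (lookup q 3rd)))

lo+j+[m∸j]≡lo+m : ∀ lo {j m} → j ≤ m → lo + j + (m ∸ j) ≡ lo + m
lo+j+[m∸j]≡lo+m lo {j} {m} j≤m = trans (+-assoc lo j (m ∸ j)) (cong (lo +_) (m+[n∸m]≡n j≤m))

top∉upper-part : ∀ {lo m j α} → j ≤ m → Perm (lo + j) (m ∸ j) α → lo + m ∉ α
top∉upper-part {lo} j≤m α-perm = Perm-∉ α-perm (≤-reflexive (lo+j+[m∸j]≡lo+m lo j≤m))

module _ {lo m j α β} (j≤m : j ≤ m) (α-perm : Perm (lo + j) (m ∸ j) α) (β-perm : Perm lo j β) where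
  private
    module α = Perm α-perm
    module β = Perm β-perm

  skew-sum : SkewSum (lo + m) α β
  skew-sum = record
    { β<α = λ a∈ b∈ → <-≤-trans (proj₂ (β.bounded b∈)) (proj₁ (α.bounded a∈))
    ; α<M = λ {a} a∈ → subst (a <_) (lo+j+[m∸j]≡lo+m lo j≤m) (proj₂ (α.bounded a∈))
    ; β<M = λ b∈ → <-≤-trans (proj₂ (β.bounded b∈)) (+-monoʳ-≤ lo j≤m)
    }

  skew-perm : Perm lo (suc m) (α ++ lo + m ∷ β)
  skew-perm = record
    { length≡ = length≡ ; bounded = bounded ; unique = Unique.++⁺ α.unique (M∉β ∷ β.unique) disjoint }
    where
    open SkewSum skew-sum
    M<hi : lo + m < lo + suc m
    M<hi = +-monoʳ-< lo (n<1+n m)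
    length≡ : length (α ++ lo + m ∷ β) ≡ suc m
    length≡ = begin
      length (α ++ lo + m ∷ β)       ≡⟨ length-++ α ⟩
      length α + suc (length β)      ≡⟨ cong₂ (λ a b → a + suc b) α.length≡ β.length≡ ⟩
      m ∸ j + suc j                  ≡⟨ +-suc (m ∸ j) j ⟩
      suc (m ∸ j + j)                ≡⟨ cong suc (m∸n+n≡m j≤m) ⟩
      suc m                          ∎
      where open ≡-Reasoning
    bounded : ∀ {x} → x ∈ α ++ lo + m ∷ β → lo ≤ x × x < lo + suc m
    bounded x∈ with ∈-++⁻ α x∈
    ... | inj₁ a∈        = ≤-trans (m≤m+n lo j) (proj₁ (α.bounded a∈)) , <-trans (α<M a∈) M<hi
    ... | inj₂ (here refl) = m≤m+n lo m , M<hi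
    ... | inj₂ (there b∈) = proj₁ (β.bounded b∈) , <-trans (β<M b∈) M<hi
    M∉β : All (lo + m ≢_) β
    M∉β = All.tabulate λ b∈ M≡b → <-irrefl (sym M≡b) (β<M b∈)
    disjoint : ∀ {v} → ¬ (v ∈ α × v ∈ lo + m ∷ β)
    disjoint (a∈ , here refl) = <-irrefl refl (α<M a∈)
    disjoint (a∈ , there b∈)  = <-irrefl refl (β<α a∈ b∈)

record Decomposition (lo m : ℕ) (π : List ℕ) : Set where
  constructor decomposition
  field
    {j}    : ℕ
    {α β}  : List ℕ
    j≤m    : j ≤ m
    π≡     : π ≡ α ++ lo + m ∷ β
    α-perm : Perm (lo + j) (m ∸ j) α
    β-perm : Perm lo j β

module MaximumSplit {lo m} (α β : List ℕ) (p : Perm lo (suc m) (α ++ lo + m ∷ β))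
                    (no132 : ¬ Has132 (α ++ lo + m ∷ β)) where
  open Perm p

  private
    M<hi : lo + m < lo + suc m
    M<hi = +-monoʳ-< lo (n<1+n m)

    distinct : ∀ {x y} → x ∷ y ∷ [] ⊆ α ++ lo + m ∷ β → x ≢ y
    distinct occ = Unique-pair occ unique

    below-M : ∀ {v} → v ∈ α ++ lo + m ∷ β → v ≢ lo + m → v < lo + m
    below-M {v} v∈ = ≤∧≢⇒< (m<1+n⇒m≤n (subst (v <_) (+-suc lo m) (proj₂ (bounded v∈))))

    α<M : ∀ {a} → a ∈ α → a < lo + m
    α<M a∈ = below-M (∈-++⁺ˡ a∈) (distinct (++⁺ (from∈ a∈) (refl ∷ minimum β)))

    β<M : ∀ {b} → b ∈ β → b < lo + m
    β<M b∈ = below-M (∈-++⁺ʳ α (there b∈)) (distinct (++⁺ (minimum α) (refl ∷ from∈ b∈)) ∘ sym)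

    -- a < b would make a, M, b an occurrence of 132.
    β<α : ∀ {a b} → a ∈ α → b ∈ β → b < a
    β<α a∈ b∈ = ≤∧≢⇒< (≮⇒≥ λ a<b → no132 (contains a,M,b⊆ (is132 a<b (β<M b∈))))
                      (distinct (++⁺ (from∈ a∈) (_ ∷ʳ from∈ b∈)) ∘ sym)
      where a,M,b⊆ = ++⁺ (from∈ a∈) (refl ∷ from∈ b∈)

    β-downward-closed : ∀ {w b} → lo ≤ w → w ≤ b → b ∈ β → w ∈ β
    β-downward-closed lo≤w w≤b b∈
      with ∈-++⁻ α (∈-complete lo≤w (<-trans (≤-<-trans w≤b (β<M b∈)) M<hi))
    ... | inj₁ w∈α         = contradiction (β<α w∈α b∈) (≤⇒≯ w≤b)
    ... | inj₂ (here refl) = contradiction (β<M b∈) (≤⇒≯ w≤b)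
    ... | inj₂ (there w∈β) = w∈β

    -- β contains all of lo, …, b, so it has more than b − lo entries.
    β<lo+j : ∀ {b} → lo ≤ b → b ∈ β → b < lo + length β
    β<lo+j {b} lo≤b b∈ = subst (_< lo + length β) (m+[n∸m]≡n lo≤b)
      (+-monoʳ-< lo (interval-⊆⇒length≥ λ w∈ → β-downward-closed (proj₁ (∈-interval⁻ w∈)) (w≤b w∈) b∈))
      where
      w≤b : ∀ {w} → w ∈ interval lo (suc (b ∸ lo)) → w ≤ b
      w≤b {w} w∈ = m<1+n⇒m≤n (subst (w <_) (trans (+-suc lo (b ∸ lo)) (cong suc (m+[n∸m]≡n lo≤b)))
                                           (proj₂ (∈-interval⁻ w∈)))

    length-α+j≡m : length α + length β ≡ m
    length-α+j≡m = suc-injective (begin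
      suc (length α + length β)  ≡⟨ +-suc (length α) (length β) ⟨
      length α + suc (length β)  ≡⟨ length-++ α ⟨
      length (α ++ lo + m ∷ β)   ≡⟨ length≡ ⟩
      suc m                      ∎)
      where open ≡-Reasoning

  j≤m : length β ≤ m
  j≤m = subst (length β ≤_) length-α+j≡m (m≤n+m (length β) (length α))

  β-perm : Perm lo (length β) β
  β-perm = record
    { length≡ = refl
    ; bounded = λ b∈ → let lo≤b = proj₁ (bounded (∈-++⁺ʳ α (there b∈))) in lo≤b , β<lo+j lo≤b b∈
    ; unique  = Unique-⊆ (β⊆α++M∷β α) unique
    }

  α-perm : Perm (lo + length β) (m ∸ length β) α
  α-perm = record
    { length≡ = subst (λ k → length α ≡ k ∸ length β) length-α+j≡m
                      (sym (m+n∸n≡m (length α) (length β)))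
    ; bounded = λ {a} a∈ → α-above-β a∈ , subst (a <_) (sym (lo+j+[m∸j]≡lo+m lo j≤m)) (α<M a∈)
    ; unique  = Unique-⊆ (α⊆α++M∷β α) unique
    }
    where
    α-above-β : ∀ {a} → a ∈ α → lo + length β ≤ a
    α-above-β a∈ = ≮⇒≥ λ a<lo+j →
      let a∈β = Perm.∈-complete β-perm (proj₁ (bounded (∈-++⁺ˡ a∈))) a<lo+j
      in distinct (++⁺ (from∈ a∈) (_ ∷ʳ from∈ a∈β)) refl

decompose : ∀ {lo m π} → Perm lo (suc m) π → ¬ Has132 π → Decomposition lo m π
decompose {lo} {m} p no132 with ∈-∃++ (Perm.∈-complete p (m≤m+n lo m) (+-monoʳ-< lo (n<1+n m)))
... | α , β , refl = decomposition j≤m refl α-perm β-perm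
  where open MaximumSplit α β p no132

-- Glued lists
glue : ℕ → List ℕ → List ℕ → List ℕ
glue M α β = α ++ M ∷ β

glue-injective : ∀ {M α α′ β β′} → M ∉ α → M ∉ α′ → glue M α β ≡ glue M α′ β′ → α ≡ α′ × β ≡ β′
glue-injective {α = []}    {[]}     _   _    eq = refl , ∷-injectiveʳ eq
glue-injective {α = []}    {_ ∷ _}  _   M∉α′ eq = contradiction (here (∷-injectiveˡ eq)) M∉α′
glue-injective {α = _ ∷ _} {[]}     M∉α _    eq = contradiction (here (sym (∷-injectiveˡ eq))) M∉α
glue-injective {α = _ ∷ _} {_ ∷ _}  M∉α M∉α′ eq with ∷-injective eq
... | refl , eq′ with glue-injective (M∉α ∘ there) (M∉α′ ∘ there) eq′
...   | refl , refl = refl , refl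

glued : ℕ → (ℕ → List (List ℕ)) → (ℕ → List (List ℕ)) → ℕ → List (List ℕ)
glued M P Q m = concatMap (λ j → cartesianProductWith (glue M) (P j) (Q j)) (upTo (suc m))

record Glues (PX QX : ℕ → List ℕ → Set) (M m : ℕ) (π : List ℕ) : Set where
  constructor glues
  field
    {j}   : ℕ
    {α β} : List ℕ
    j≤m   : j ≤ m
    π≡    : π ≡ glue M α β
    left  : PX j α
    right : QX j β

module _ {PX QX : ℕ → List ℕ → Set} {P Q : ℕ → List (List ℕ)}
         (P-enum : ∀ j → Enumerates (PX j) (P j)) (Q-enum : ∀ j → Enumerates (QX j) (Q j)) where
  private
    module P j = Enumerates (P-enum j)
    module Q j = Enumerates (Q-enum j)

  ∈-glued⇔ : ∀ {M m π} → π ∈ glued M P Q m ⇔ Glues PX QX M m π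
  ∈-glued⇔ {M} {m} = mk⇔ sound complete
    where
    sound : ∀ {π} → π ∈ glued M P Q m → Glues PX QX M m π
    sound π∈ with find (∈-concatMap⁻ _ {upTo (suc m)} π∈)
    ... | j , j∈ , π∈′ with ∈-cartesianProductWith⁻ (glue M) (P j) (Q j) π∈′
    ...   | α , β , α∈ , β∈ , refl = glues (m<1+n⇒m≤n (∈-upTo⁻ j∈)) refl (P.sound j α∈) (Q.sound j β∈)
    complete : ∀ {π} → Glues PX QX M m π → π ∈ glued M P Q m
    complete (glues {j} j≤m refl l r) = ∈-concatMap⁺ _
      (lose (∈-upTo⁺ (s≤s j≤m)) (∈-cartesianProductWith⁺ (glue M) (P.complete j l) (Q.complete j r)))

  glued-unique : ∀ {M m} → (∀ {j α} → j ≤ m → PX j α → M ∉ α) → (∀ {j β} → QX j β → length β ≡ j) →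
                 Unique (glued M P Q m)
  glued-unique {M} {m} M∉ length-β = Unique-concatMap (Unique.upTo⁺ (suc m)) block-unique same-block
    where
    M∉P : ∀ {j α} → j ∈ upTo (suc m) → α ∈ P j → M ∉ α
    M∉P j∈ α∈ = M∉ (m<1+n⇒m≤n (∈-upTo⁻ j∈)) (P.sound _ α∈)

    block-unique : ∀ {j} → j ∈ upTo (suc m) → Unique (cartesianProductWith (glue M) (P j) (Q j))
    block-unique {j} j∈ = Unique-cartesianProductWith (P.unique j) (Q.unique j)
      λ α∈ α′∈ → glue-injective (M∉P j∈ α∈) (M∉P j∈ α′∈)

    same-block : ∀ {j j′ π} → j ∈ upTo (suc m) → j′ ∈ upTo (suc m) →
                 π ∈ cartesianProductWith (glue M) (P j) (Q j) →
                 π ∈ cartesianProductWith (glue M) (P j′) (Q j′) → j ≡ j′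
    same-block {j} {j′} j∈ j′∈ π∈ π∈′
      with ∈-cartesianProductWith⁻ (glue M) (P j) (Q j) π∈
         | ∈-cartesianProductWith⁻ (glue M) (P j′) (Q j′) π∈′
    ... | _ , β , α∈ , β∈ , refl | _ , β′ , α′∈ , β′∈ , eq = begin
      j         ≡⟨ length-β (Q.sound j β∈) ⟨
      length β  ≡⟨ cong length (proj₂ (glue-injective (M∉P j∈ α∈) (M∉P j′∈ α′∈) eq)) ⟩
      length β′ ≡⟨ length-β (Q.sound j′ β′∈) ⟩
      j′        ∎
      where open ≡-Reasoning

  glued-enumerates : ∀ {X : List ℕ → Set} {M m} →
                     (∀ {j α} → j ≤ m → PX j α → M ∉ α) → (∀ {j β} → QX j β → length β ≡ j) →
                     (∀ {π} → Glues PX QX M m π ⇔ X π) → Enumerates X (glued M P Q m)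
  glued-enumerates M∉ length-β Glues⇔X = record
    { unique   = glued-unique M∉ length-β
    ; sound    = to Glues⇔X ∘ to ∈-glued⇔
    ; complete = from ∈-glued⇔ ∘ from Glues⇔X
    }

length-concatMap : ∀ {A B : Set} (f : A → List B) xs →
                   length (concatMap f xs) ≡ sum (map (length ∘ f) xs)
length-concatMap f []       = refl
length-concatMap f (x ∷ xs) = trans (length-++ (f x)) (cong (length (f x) +_) (length-concatMap f xs))

length-cartesianProductWith : ∀ {A B C : Set} (f : A → B → C) xs ys →
                              length (cartesianProductWith f xs ys) ≡ length xs * length ys
length-cartesianProductWith f []       ys = refl
length-cartesianProductWith f (x ∷ xs) ys =
  trans (length-++ (map (f x) ys)) (cong₂ _+_ (length-map (f x) ys) (length-cartesianProductWith f xs ys))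

∑< : ℕ → (ℕ → ℕ) → ℕ
∑< n f = sum (map f (upTo n))

syntax ∑< n (λ j → e) = ∑[ j < n ] e

∑<-suc : ∀ n f → ∑< (suc n) f ≡ f 0 + ∑< n (f ∘ suc)
∑<-suc n f = cong (λ xs → f 0 + sum xs) (trans (map-applyUpTo suc f n) (sym (map-upTo (f ∘ suc) n)))

∑<-cong : ∀ n {f g} → (∀ {j} → j < n → f j ≡ g j) → ∑< n f ≡ ∑< n g
∑<-cong zero    f≡g = refl
∑<-cong (suc n) {f} {g} f≡g = begin
  ∑< (suc n) f            ≡⟨ ∑<-suc n f ⟩
  f 0 + ∑< n (f ∘ suc)    ≡⟨ cong₂ _+_ (f≡g z<s) (∑<-cong n (f≡g ∘ s<s)) ⟩
  g 0 + ∑< n (g ∘ suc)    ≡⟨ ∑<-suc n g ⟨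
  ∑< (suc n) g            ∎
  where open ≡-Reasoning

∑<-1 : ∀ n → ∑[ _ < n ] 1 ≡ n
∑<-1 zero    = refl
∑<-1 (suc n) = trans (∑<-suc n (λ _ → 1)) (cong suc (∑<-1 n))

∑<-*ˡ : ∀ n k f → ∑[ j < n ] (k * f j) ≡ k * ∑< n f
∑<-*ˡ zero    k f = sym (*-zeroʳ k)
∑<-*ˡ (suc n) k f = begin
  ∑[ j < suc n ] (k * f j)           ≡⟨ ∑<-suc n (λ j → k * f j) ⟩
  k * f 0 + ∑[ j < n ] (k * f (suc j)) ≡⟨ cong (k * f 0 +_) (∑<-*ˡ n k (f ∘ suc)) ⟩
  k * f 0 + k * ∑< n (f ∘ suc)       ≡⟨ *-distribˡ-+ k (f 0) _ ⟨
  k * (f 0 + ∑< n (f ∘ suc))         ≡⟨ cong (k *_) (∑<-suc n f) ⟨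
  k * ∑< (suc n) f                   ∎
  where open ≡-Reasoning

1+∑<2^≡2^ : ∀ n → 1 + ∑[ j < n ] (2 ^ j) ≡ 2 ^ n
1+∑<2^≡2^ zero    = refl
1+∑<2^≡2^ (suc n) = begin
  1 + ∑[ j < suc n ] (2 ^ j)        ≡⟨ cong suc (∑<-suc n (2 ^_)) ⟩
  1 + (1 + ∑[ j < n ] (2 * 2 ^ j))  ≡⟨ cong (λ s → 1 + (1 + s)) (∑<-*ˡ n 2 (2 ^_)) ⟩
  1 + (1 + 2 * ∑[ j < n ] (2 ^ j))  ≡⟨ *-suc 2 _ ⟨
  2 * (1 + ∑[ j < n ] (2 ^ j))      ≡⟨ cong (2 *_) (1+∑<2^≡2^ n) ⟩
  2 * 2 ^ n                         ∎
  where open ≡-Reasoning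

length-glued : ∀ M P Q m → length (glued M P Q m) ≡ ∑[ j < suc m ] (length (P j) * length (Q j))
length-glued M P Q m =
  trans (length-concatMap (λ j → cartesianProductWith (glue M) (P j) (Q j)) (upTo (suc m)))
        (cong sum (map-cong (λ j → length-cartesianProductWith (glue M) (P j) (Q j)) (upTo (suc m))))

-- The three classes
B-shapes : List (List ℕ → Set)
B-shapes = Is132 ∷ Is213 ∷ []

B : ℕ → ℕ → List (List ℕ)
B = avoiders (σ132 ∷ σ213 ∷ [])

B-enumerates : ∀ lo n → Enumerates (Avoiding B-shapes lo n) (B lo n)
B-enumerates = avoiders-enumerates (recognises-132 ∷ recognises-213 ∷ [])

B-glued : ℕ → ℕ → List (List ℕ)
B-glued lo m = glued (lo + m) (λ j → [ interval (lo + j) (m ∸ j) ]) (B lo) m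

module _ (lo m : ℕ) where
  private
    B-Glues : List ℕ → Set
    B-Glues = Glues (λ j α → α ≡ interval (lo + j) (m ∸ j)) (Avoiding B-shapes lo) (lo + m) m

    from-glues : ∀ {π} → B-Glues π → Avoiding B-shapes lo (suc m) π
    from-glues (glues j≤m refl refl (β-perm , no132 , no213 , _)) =
      skew-perm j≤m (interval-perm _ _) β-perm ,
      [ interval-avoids-21 _ _ ∘ Contains-trans 132⇒21 , no132 ]′ ∘ 132-split skew ,
      [ interval-avoids-21 _ _ , no213 ]′ ∘ 213-split skew ,
      tt
      where skew = skew-sum j≤m (interval-perm _ _) β-perm

    to-glues : ∀ {π} → Avoiding B-shapes lo (suc m) π → B-Glues π
    to-glues (p , no132 , no213 , _) with decompose p no132
    ... | decomposition {α = α} j≤m refl α-perm β-perm =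
      glues j≤m refl (21-avoiding-perm≡interval α-perm (no213 ∘ 21-in-α⇒213 skew))
            (β-perm , no132 ∘ Contains-mono (β⊆α++M∷β α) , no213 ∘ Contains-mono (β⊆α++M∷β α) , tt)
      where skew = skew-sum j≤m α-perm β-perm

  B-glued-enumerates : Enumerates (Avoiding B-shapes lo (suc m)) (B-glued lo m)
  B-glued-enumerates = glued-enumerates (λ j → singleton-enumerates _) (B-enumerates lo)
    (λ { j≤m refl → top∉upper-part j≤m (interval-perm _ _) }) (Perm.length≡ ∘ proj₁)
    (mk⇔ from-glues to-glues)

b-count : ℕ → ℕ
b-count zero    = 1
b-count (suc m) = 2 ^ m

length-B : ∀ lo n → length (B lo n) ≡ b-count n
length-B lo = <-rec (λ n → length (B lo n) ≡ b-count n) step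
  where
  open ≡-Reasoning
  step : ∀ n → (∀ {j} → j < n → length (B lo j) ≡ b-count j) → length (B lo n) ≡ b-count n
  step zero    _  = refl
  step (suc m) ih = begin
    length (B lo (suc m))
      ≡⟨ Enumerates-length (B-enumerates lo (suc m)) (B-glued-enumerates lo m) ⟩
    length (B-glued lo m)
      ≡⟨ length-glued (lo + m) (λ j → [ interval (lo + j) (m ∸ j) ]) (B lo) m ⟩
    ∑[ j < suc m ] (1 * length (B lo j))
      ≡⟨ ∑<-cong (suc m) (λ j<1+m → trans (*-identityˡ _) (ih j<1+m)) ⟩
    ∑[ j < suc m ] (b-count j)
      ≡⟨ trans (∑<-suc m b-count) (1+∑<2^≡2^ m) ⟩
    2 ^ m
      ∎

C-shapes : List (List ℕ → Set)
C-shapes = Is132 ∷ Is321 ∷ []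

C : ℕ → ℕ → List (List ℕ)
C = avoiders (σ132 ∷ σ321 ∷ [])

C-enumerates : ∀ lo n → Enumerates (Avoiding C-shapes lo n) (C lo n)
C-enumerates = avoiders-enumerates (recognises-132 ∷ recognises-321 ∷ [])

C-Left : ℕ → ℕ → ℕ → List ℕ → Set
C-Left lo m zero    α = Avoiding C-shapes lo m α
C-Left lo m (suc j) α = α ≡ interval (lo + suc j) (m ∸ suc j)

C-left : ℕ → ℕ → ℕ → List (List ℕ)
C-left lo m zero    = C lo m
C-left lo m (suc j) = [ interval (lo + suc j) (m ∸ suc j) ]

C-left-enumerates : ∀ lo m j → Enumerates (C-Left lo m j) (C-left lo m j)
C-left-enumerates lo m zero    = C-enumerates lo m
C-left-enumerates lo m (suc j) = singleton-enumerates _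

C-glued : ℕ → ℕ → List (List ℕ)
C-glued lo m = glued (lo + m) (C-left lo m) (λ j → [ interval lo j ]) m

module _ (lo m : ℕ) where
  private
    C-Glues : List ℕ → Set
    C-Glues = Glues (C-Left lo m) (λ j β → β ≡ interval lo j) (lo + m) m

    Perm-lo+0 : ∀ {n α} → Perm (lo + 0) n α ⇔ Perm lo n α
    Perm-lo+0 {n} {α} = mk⇔ (subst (λ l → Perm l n α) (+-identityʳ lo))
                            (subst (λ l → Perm l n α) (sym (+-identityʳ lo)))

    from-glues : ∀ {π} → C-Glues π → Avoiding C-shapes lo (suc m) π
    from-glues (glues {zero} j≤m refl (α-perm , α132 , α321 , _) refl) =
      skew-perm j≤m (from Perm-lo+0 α-perm) (interval-perm lo 0) ,
      [ α132 , (λ { (contains [] ()) }) ]′ ∘ 132-split skew ,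
      [ α321 , [ interval-avoids-21 lo 0 , (λ ()) ∘ proj₂ ∘ proj₂ ]′ ]′ ∘ 321-split skew ,
      tt
      where skew = skew-sum j≤m (from Perm-lo+0 α-perm) (interval-perm lo 0)
    from-glues (glues {suc j} j≤m refl refl refl) =
      skew-perm j≤m (interval-perm _ _) (interval-perm _ _) ,
      [ no21 ∘ Contains-trans 132⇒21 , no21 ∘ Contains-trans 132⇒21 ]′ ∘ 132-split skew ,
      [ no21 ∘ Contains-trans 321⇒21 , [ no21 , no21 ∘ proj₁ ]′ ]′ ∘ 321-split skew ,
      tt
      where
      skew = skew-sum j≤m (interval-perm _ _) (interval-perm _ _)
      no21 : ∀ {lo′ n} → ¬ Has21 (interval lo′ n)
      no21 = interval-avoids-21 _ _

    -- Unless β is empty, a 21 in α together with an entry of β is a 321.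
    left-part : ∀ j {α β} → j ≤ m → Perm (lo + j) (m ∸ j) α → Perm lo j β →
           ¬ Has132 (α ++ lo + m ∷ β) → ¬ Has321 (α ++ lo + m ∷ β) → C-Left lo m j α
    left-part zero    {α} j≤m α-perm β-perm no132 no321 =
      to Perm-lo+0 α-perm , no132 ∘ Contains-mono (α⊆α++M∷β α) , no321 ∘ Contains-mono (α⊆α++M∷β α) , tt
    left-part (suc j) j≤m α-perm β-perm no132 no321 = 21-avoiding-perm≡interval α-perm λ h →
      no321 (21-in-α⇒321 (skew-sum j≤m α-perm β-perm) h (Perm.∈-complete β-perm ≤-refl (m<m+n lo z<s)))

    to-glues : ∀ {π} → Avoiding C-shapes lo (suc m) π → C-Glues π
    to-glues (p , no132 , no321 , _) with decompose p no132
    ... | decomposition {j} j≤m refl α-perm β-perm =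
      glues j≤m refl (left-part j j≤m α-perm β-perm no132 no321)
            (21-avoiding-perm≡interval β-perm (no321 ∘ 21-in-β⇒321 (skew-sum j≤m α-perm β-perm)))

  C-glued-enumerates : Enumerates (Avoiding C-shapes lo (suc m)) (C-glued lo m)
  C-glued-enumerates = glued-enumerates (C-left-enumerates lo m) (λ j → singleton-enumerates _)
    M∉ (λ { refl → length-interval lo _ }) (mk⇔ from-glues to-glues)
    where
    M∉ : ∀ {j α} → j ≤ m → C-Left lo m j α → lo + m ∉ α
    M∉ {zero}  j≤m (α-perm , _) = top∉upper-part j≤m (from Perm-lo+0 α-perm)
    M∉ {suc j} j≤m refl         = top∉upper-part j≤m (interval-perm _ _)

c-count : ℕ → ℕ
c-count zero    = 1
c-count (suc m) = c-count m + m

length-C : ∀ lo m → length (C lo m) ≡ c-count m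
length-C lo zero    = refl
length-C lo (suc m) = begin
  length (C lo (suc m))
    ≡⟨ Enumerates-length (C-enumerates lo (suc m)) (C-glued-enumerates lo m) ⟩
  length (C-glued lo m)
    ≡⟨ length-glued (lo + m) (C-left lo m) (λ j → [ interval lo j ]) m ⟩
  ∑[ j < suc m ] (length (C-left lo m j) * 1)
    ≡⟨ ∑<-suc m _ ⟩
  length (C lo m) * 1 + ∑[ _ < m ] 1
    ≡⟨ cong₂ _+_ (trans (*-identityʳ _) (length-C lo m)) (∑<-1 m) ⟩
  c-count m + m
    ∎
  where open ≡-Reasoning

A-shapes : List (List ℕ → Set)
A-shapes = Is132 ∷ Is3214 ∷ Is4213 ∷ []

A-enumerates : ∀ n → Enumerates (Avoiding A-shapes 0 n) (Av n (σ132 ∷ σ3214 ∷ σ4213 ∷ []))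
A-enumerates = Av-enumerates (recognises-132 ∷ recognises-3214 ∷ recognises-4213 ∷ [])

A-glued : ℕ → List (List ℕ)
A-glued m = glued m (λ j → C j (m ∸ j)) (B 0) m

module _ (m : ℕ) where
  private
    A-Glues : List ℕ → Set
    A-Glues = Glues (λ j → Avoiding C-shapes j (m ∸ j)) (Avoiding B-shapes 0) m m

    from-glues : ∀ {π} → A-Glues π → Avoiding A-shapes 0 (suc m) π
    from-glues (glues j≤m refl (α-perm , α132 , α321 , _) (β-perm , β132 , β213 , _)) =
      skew-perm j≤m α-perm β-perm ,
      [ α132 , β132 ]′ ∘ 132-split skew ,
      [ α321 , β213 ∘ Contains-trans 3214⇒213 ]′ ∘ 3214-split skew ,
      [ α321 ∘ Contains-trans 4213⇒321 , β213 ]′ ∘ 4213-split skew ,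
      tt
      where skew = skew-sum j≤m α-perm β-perm

    to-glues : ∀ {π} → Avoiding A-shapes 0 (suc m) π → A-Glues π
    to-glues (p , no132 , no3214 , no4213 , _) with decompose p no132
    ... | decomposition {α = α} j≤m refl α-perm β-perm =
      glues j≤m refl (α-perm , no132 ∘ Contains-mono (α⊆α++M∷β α) , no3214 ∘ 321-in-α⇒3214 skew , tt)
                     (β-perm , no132 ∘ Contains-mono (β⊆α++M∷β α) , no4213 ∘ 213-in-β⇒4213 skew , tt)
      where skew = skew-sum j≤m α-perm β-perm

  A-glued-enumerates : Enumerates (Avoiding A-shapes 0 (suc m)) (A-glued m)
  A-glued-enumerates = glued-enumerates (λ j → C-enumerates j (m ∸ j)) (B-enumerates 0)
    (λ j≤m → top∉upper-part {0} j≤m ∘ proj₁) (Perm.length≡ ∘ proj₁) (mk⇔ from-glues to-glues)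

length-Av : ∀ m → length (Av (suc m) (σ132 ∷ σ3214 ∷ σ4213 ∷ [])) ≡
                  ∑[ j < suc m ] (c-count (m ∸ j) * b-count j)
length-Av m = begin
  length (Av (suc m) (σ132 ∷ σ3214 ∷ σ4213 ∷ []))
    ≡⟨ Enumerates-length (A-enumerates (suc m)) (A-glued-enumerates m) ⟩
  length (A-glued m)
    ≡⟨ length-glued m (λ j → C j (m ∸ j)) (B 0) m ⟩
  ∑[ j < suc m ] (length (C j (m ∸ j)) * length (B 0 j))
    ≡⟨ ∑<-cong (suc m) (λ {j} _ → cong₂ _*_ (length-C j (m ∸ j)) (length-B 0 j)) ⟩
  ∑[ j < suc m ] (c-count (m ∸ j) * b-count j)
    ∎
  where open ≡-Reasoning

c-b-convolution : ∀ m → ∑[ j < suc m ] (c-count (m ∸ j) * b-count j) + suc m ≡ 2 ^ suc m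
c-b-convolution m = begin
  ∑[ j < suc m ] (c-count (m ∸ j) * b-count j) + suc m  ≡⟨ cong (_+ suc m) (∑<-suc m _) ⟩
  c-count m * 1 + W m + suc m                            ≡⟨ cong (λ x → x + W m + suc m) (*-identityʳ _) ⟩
  c-count m + W m + suc m                                ≡⟨ cong (_+ suc m) (+-comm (c-count m) (W m)) ⟩
  W m + c-count m + suc m                                ≡⟨ W-closed m ⟩
  2 ^ suc m                                              ∎
  where
  open ≡-Reasoning
  W : ℕ → ℕ
  W n = ∑[ j < n ] (c-count (n ∸ suc j) * 2 ^ j)

  W-suc : ∀ n → W (suc n) ≡ c-count n * 1 + 2 * W n
  W-suc n = begin
    W (suc n)
      ≡⟨ ∑<-suc n _ ⟩
    c-count n * 1 + ∑[ j < n ] (c-count (n ∸ suc j) * (2 * 2 ^ j))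
      ≡⟨ cong (c-count n * 1 +_) (∑<-cong n (λ {j} _ → swap (c-count (n ∸ suc j)) (2 ^ j))) ⟩
    c-count n * 1 + ∑[ j < n ] (2 * (c-count (n ∸ suc j) * 2 ^ j))
      ≡⟨ cong (c-count n * 1 +_) (∑<-*ˡ n 2 _) ⟩
    c-count n * 1 + 2 * W n
      ∎
    where
    swap : ∀ x y → x * (2 * y) ≡ 2 * (x * y)
    swap = solve-∀

  W-closed : ∀ n → W n + c-count n + suc n ≡ 2 ^ suc n
  W-closed zero    = refl
  W-closed (suc n) = begin
    W (suc n) + c-count (suc n) + suc (suc n)
      ≡⟨ cong (λ x → x + c-count (suc n) + suc (suc n)) (W-suc n) ⟩
    c-count n * 1 + 2 * W n + (c-count n + n) + suc (suc n)
      ≡⟨ rearrange (W n) (c-count n) n ⟩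
    2 * (W n + c-count n + suc n)
      ≡⟨ cong (2 *_) (W-closed n) ⟩
    2 * 2 ^ suc n
      ∎
    where
    rearrange : ∀ w c k → c * 1 + 2 * w + (c + k) + suc (suc k) ≡ 2 * (w + c + suc k)
    rearrange = solve-∀

mainTheorem2 : ∀ (n : ℕ) → length (Av n ((0 ∷ 2 ∷ 1 ∷ []) ∷ (2 ∷ 1 ∷ 0 ∷ 3 ∷ []) ∷ (3 ∷ 1 ∷ 0 ∷ 2 ∷ []) ∷ [])) ≡ 2 ^ n ∸ n
mainTheorem2 zero    = refl
mainTheorem2 (suc m) = begin
  length (Av (suc m) (σ132 ∷ σ3214 ∷ σ4213 ∷ []))  ≡⟨ length-Av m ⟩
  total                                             ≡⟨ m+n∸n≡m total (suc m) ⟨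
  total + suc m ∸ suc m                             ≡⟨ cong (_∸ suc m) (c-b-convolution m) ⟩
  2 ^ suc m ∸ suc m                                 ∎
  where
  open ≡-Reasoning
  total = ∑[ j < suc m ] (c-count (m ∸ j) * b-count j)
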